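{- Let $\mathcal{L} = (G, a_0, I, \theta)$ be a ladget. Then $a_0$ and $\theta$ are not adjacent in $G$.
   Context: A ladget is a tuple $\mathcal{L}=(G,a_0,I,\theta)$ where $G=(V,E)$ is a finite simple graph, $a_0\in V$ is the anchor vertex, $I=(i_1,\dots,i_n)$ with $n\ge 1$ is an ordered tuple of distinct input vertices, and $\theta\in V$ is the output vertex, with $a_0$, the inputs and $\theta$ pairwise distinct. A valid 3-coloring is a proper coloring $c:V\to\{0,1,2\}$ (adjacent vertices get distinct colors) with $c(a_0)=0$. A vertex has Boolean value $0$ if its color is $0$ and Boolean value $1$ if its color is in $\{1,2\}$. $\mathcal{L}$ is required to implement a Boolean function $\varphi:\{0,1\}^n\to\{0,1\}$ that depends on every input (i.e. for each input coordinate, changing it can change the value of $\varphi$), meaning: (Universality) every assignment of colors from $\{0,1,2\}$ to the input vertices extends to a valid 3-coloring; (Consistency) in every valid 3-coloring, the Boolean value of $\theta$ equals $\varphi$ applied to the Boolean values of $i_1,\dots,i_n$. -}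

module Defs where

open import Data.Nat using (ℕ; suc)
open import Data.Fin using (Fin; zero)
open import Data.Bool using (Bool; true; false; not)
open import Data.Vec using (Vec; lookup; map; _[_]≔_)
open import Data.Product using (Σ; _×_; ∃; _,_)
open import Relation.Nullary using (¬_)
open import Relation.Binary.PropositionalEquality using (_≡_; _≢_)
open import Level using (0ℓ)

record SimpleGraph (N : ℕ) : Set₁ where
  field
    Adj     : Fin N → Fin N → Set
    irrefl  : ∀ v → ¬ Adj v v
    sym     : ∀ {u v} → Adj u v → Adj v u

Color : Set
Color = Fin 3

boolOf : Color → Bool
boolOf zero = false
boolOf _    = true

ValidColoring : ∀ {N} → SimpleGraph N → Fin N → (Fin N → Color) → Set
ValidColoring {N} G a₀ c =
  (∀ u v → SimpleGraph.Adj G u v → c u ≢ c v) × (c a₀ ≡ zero)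

DependsOnAll : ∀ {n} → (Vec Bool n → Bool) → Set
DependsOnAll {n} φ = ∀ (k : Fin n) → ∃ λ (x : Vec Bool n) →
  φ x ≢ φ (x [ k ]≔ not (lookup x k))

-- Ladget (G, a₀, I, θ) with n ≥ 1 inputs (n = suc m) implementing φ.
record Ladget (N m : ℕ) : Set₁ where
  field
    G      : SimpleGraph N
    a₀     : Fin N
    I      : Vec (Fin N) (suc m)
    θ      : Fin N
    inputsDistinct : ∀ (j k : Fin (suc m)) → lookup I j ≡ lookup I k → j ≡ k
    a₀∉I   : ∀ (k : Fin (suc m)) → lookup I k ≢ a₀
    θ∉I    : ∀ (k : Fin (suc m)) → lookup I k ≢ θ
    a₀≢θ   : a₀ ≢ θ

Implements : ∀ {N m} → Ladget N m → (Vec Bool (suc m) → Bool) → Set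
Implements {N} {m} L φ =
  (∀ (col : Vec Color (suc m)) → ∃ λ (c : Fin N → Color) →
      ValidColoring G a₀ c × (∀ k → c (lookup I k) ≡ lookup col k))
  × (∀ (c : Fin N → Color) → ValidColoring G a₀ c →
      boolOf (c θ) ≡ φ (map (λ v → boolOf (c v)) I))
  where open Ladget L

{-# OPTIONS --safe #-}
module Submission where

open import Defs
open import Data.Nat using (suc)
open import Data.Bool using (Bool; true; false)
open import Data.Vec using (Vec; lookup; map; tabulate)
open import Data.Vec.Properties using (lookup-map; tabulate∘lookup; tabulate-cong)
open import Data.Fin using (Fin; zero; suc)
open import Data.Product using (∃; _×_; _,_)
open import Relation.Nullary using (¬_; contradiction)
open import Relation.Binary.PropositionalEquality using (_≡_; _≢_; refl; sym; trans; cong; module ≡-Reasoning)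

-- If θ were adjacent to the anchor it could never receive color 0, so its Boolean value would be
-- 1 in every valid coloring.  By universality every Boolean input vector is realised by some valid
-- coloring, so consistency forces φ to be constantly true, and a constant function depends on no input.

fromBool : Bool → Color
fromBool false = zero
fromBool true  = suc zero

boolOf-fromBool : ∀ b → boolOf (fromBool b) ≡ b
boolOf-fromBool false = refl
boolOf-fromBool true  = refl

boolOf-≢zero : ∀ {c : Color} → c ≢ zero → boolOf c ≡ true
boolOf-≢zero {zero}  c≢0 = contradiction refl c≢0
boolOf-≢zero {suc _} _   = refl

lookup-extensionality : ∀ {A : Set} {n} {xs ys : Vec A n} →
  (∀ i → lookup xs i ≡ lookup ys i) → xs ≡ ys
lookup-extensionality {xs = xs} {ys} eq = begin
  xs                   ≡⟨ sym (tabulate∘lookup xs) ⟩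
  tabulate (lookup xs) ≡⟨ tabulate-cong eq ⟩
  tabulate (lookup ys) ≡⟨ tabulate∘lookup ys ⟩
  ys                   ∎
  where open ≡-Reasoning

constant⇒¬DependsOnAll : ∀ {m} {φ : Vec Bool (suc m) → Bool} (b : Bool) →
  (∀ x → φ x ≡ b) → ¬ DependsOnAll φ
constant⇒¬DependsOnAll b const dep with dep zero
... | x , φ-changes = φ-changes (trans (const x) (sym (const _)))

adjacent-to-anchor⇒true : ∀ {N} {G : SimpleGraph N} {a₀ v : Fin N} {c : Fin N → Color} →
  ValidColoring G a₀ c → SimpleGraph.Adj G a₀ v → boolOf (c v) ≡ true
adjacent-to-anchor⇒true (proper , c-a₀≡0) adj =
  boolOf-≢zero λ c-v≡0 → proper _ _ adj (trans c-a₀≡0 (sym c-v≡0))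

module _ {N m} (L : Ladget N m) where
  open Ladget L

  inputValues : (Fin N → Color) → Vec Bool (suc m)
  inputValues c = map (λ v → boolOf (c v)) I

  realizable : ∀ {φ} → Implements L φ → (x : Vec Bool (suc m)) →
    ∃ λ c → ValidColoring G a₀ c × inputValues c ≡ x
  realizable (universal , _) x with universal (map fromBool x)
  ... | c , valid , inputs≡ = c , valid , lookup-extensionality inputValue≡
    where
    open ≡-Reasoning
    inputValue≡ : ∀ k → lookup (inputValues c) k ≡ lookup x k
    inputValue≡ k = begin
      lookup (inputValues c) k           ≡⟨ lookup-map k _ I ⟩
      boolOf (c (lookup I k))            ≡⟨ cong boolOf (inputs≡ k) ⟩
      boolOf (lookup (map fromBool x) k) ≡⟨ cong boolOf (lookup-map k fromBool x) ⟩
      boolOf (fromBool (lookup x k))     ≡⟨ boolOf-fromBool (lookup x k) ⟩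
      lookup x k                         ∎

  adjacent-output⇒constant : ∀ {φ} → Implements L φ → SimpleGraph.Adj G a₀ θ →
    ∀ x → φ x ≡ true
  adjacent-output⇒constant {φ} impl@(_ , consistent) adj x with realizable {φ} impl x
  ... | c , valid , refl = begin
    φ (inputValues c) ≡⟨ sym (consistent c valid) ⟩
    boolOf (c θ)      ≡⟨ adjacent-to-anchor⇒true {G = G} valid adj ⟩
    true              ∎
    where open ≡-Reasoning

mainTheorem6 : ∀ {N m} (L : Ladget N m) (φ : Vec Bool (suc m) → Bool) →
    DependsOnAll φ → Implements L φ →
    ¬ SimpleGraph.Adj (Ladget.G L) (Ladget.a₀ L) (Ladget.θ L)
mainTheorem6 L φ dep impl adj =
  constant⇒¬DependsOnAll true (adjacent-output⇒constant L impl adj) dep
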